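{- For every integer $n\geq 3$, with $C_n$ the cycle of length $n$, $$\mathcal{R}(n)\leq bc(K_{n,n}\setminus C_{2n})=N(C_n)\leq 2\lceil\log_2 n\rceil+1.$$
   Context: $\mathcal{R}(s)=\min\{c : \binom{c}{\lfloor c/2\rfloor}\geq s\}$. $K_{n,n}\setminus C_{2n}$ is $K_{n,n}$ with the edges of a Hamiltonian cycle removed. A biclique is a complete bipartite subgraph; $bc(H)$ is the smallest number of bicliques of $H$ whose union contains every edge of $H$. For a graph $G$, a covering of $G$ is a collection of subsets $A_1,\ldots,A_k$ of $V(G)$ such that for every edge $\{u,v\}$ and every vertex $x\notin\{u,v\}$ there is some $A_j$ with $\{u,v\}\subseteq A_j$ and $x\notin A_j$; $N(G)$ is the minimum size of a covering of $G$. -}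

module Defs where

open import Data.Nat using (ℕ; zero; suc; _≤_; ⌊_/2⌋)
open import Data.Nat.Combinatorics using (_C_)
open import Data.Fin using (Fin; toℕ)
open import Data.Fin.Subset using (Subset; _∈_; _∉_)
open import Data.Product using (Σ; _×_; ∃-syntax)
open import Data.Sum using (_⊎_)
open import Relation.Binary.PropositionalEquality using (_≡_; _≢_)
open import Relation.Nullary using (¬_)

IsLeast : (ℕ → Set) → ℕ → Set
IsLeast P k = P k × (∀ j → P j → k ≤ j)

IsR : ℕ → ℕ → Set
IsR s = IsLeast (λ c → s ≤ c C ⌊ c /2⌋)

Next : (n : ℕ) → Fin n → Fin n → Set
Next n i j = (suc (toℕ i) ≡ toℕ j) ⊎ ((suc (toℕ i) ≡ n) × (toℕ j ≡ 0))

CycleEdge : (n : ℕ) → Fin n → Fin n → Set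
CycleEdge n u v = Next n u v ⊎ Next n v u

-- K_{n,n} \ C_{2n}: left part Fin n, right part Fin n. The removed
-- Hamiltonian cycle is L0 R1 L1 R2 ... L(n-1) R0 L0, i.e. the edges
-- Li–Ri and Li–R(i+1 mod n). Left i is adjacent to right j iff neither.
KnnMinusC2nEdge : (n : ℕ) → Fin n → Fin n → Set
KnnMinusC2nEdge n i j = (i ≢ j) × ¬ Next n i j

IsBiclique : (n : ℕ) → Subset n → Subset n → Set
IsBiclique n A B = ∀ i j → i ∈ A → j ∈ B → KnnMinusC2nEdge n i j

BicliqueCover : (n k : ℕ) → Set
BicliqueCover n k =
  Σ (Fin k → Subset n) λ A → Σ (Fin k → Subset n) λ B →
    (∀ t → IsBiclique n (A t) (B t)) ×
    (∀ i j → KnnMinusC2nEdge n i j → ∃[ t ] (i ∈ A t × j ∈ B t))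

IsBC : ℕ → ℕ → Set
IsBC n = IsLeast (BicliqueCover n)

CycleCovering : (n k : ℕ) → Set
CycleCovering n k =
  Σ (Fin k → Subset n) λ A →
    ∀ u v → CycleEdge n u v → ∀ x → x ≢ u → x ≢ v →
      ∃[ t ] (u ∈ A t × v ∈ A t × x ∉ A t)

IsN : ℕ → ℕ → Set
IsN n = IsLeast (CycleCovering n)

-- A covering of C_n is the same thing as a biclique cover of K_{n,n} ∖ C_{2n}:
-- left vertex i plays the edge {i, i+1}, right vertex j the vertex j, and a
-- set A becomes the biclique (edges inside A) × (complement of A).  For the
-- lower bound, record for every vertex y the set of covering sets containing
-- it; when n ≥ 3 these n signatures form an antichain of subsets of the k
-- indices, so Sperner's theorem (proved through the LYM inequality) gives
-- n ≤ binom(k, ⌊k/2⌋).  For the upper bound, label the vertices by L-bit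
-- Gray codes, L = ⌈log₂ n⌉: consecutive labels differ in a single bit and
-- distinct labels differ somewhere, so some bit on which i and i+1 agree
-- separates them from any third vertex; the 2L sets "bit b equals β" plus
-- {0, n − 1} for the closing edge form a covering of size 2L + 1.

module Submission where

open import Defs
open import Data.Nat as ℕ using (ℕ; zero; suc; _≤_; _<_; _+_; _*_; _∸_; _^_; _!; z≤n; s≤s; ⌊_/2⌋; ⌈_/2⌉)
open import Data.Nat.Properties
open import Data.Nat.Induction using (<-rec)
open import Data.Nat.Divisibility using (_∣_; ∣⇒≤)
open import Data.Nat.DivMod using (m/n*n≡m)
open import Data.Nat.Combinatorics using (_C_; k![n∸k]!∣n!)
open import Data.Nat.Combinatorics.Specification using (nCk≡n!/k![n-k]!)
open import Data.Nat.Logarithm using (⌈log₂_⌉; ⌈log₂⌈n/2⌉⌉≡⌈log₂n⌉∸1; ⌈log₂⌉-mono-≤)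
open import Data.Nat.ListAction using (sum)
open import Data.Fin as Fin using (Fin; toℕ; fromℕ<; splitAt; _↑ˡ_; _↑ʳ_)
open import Data.Fin.Properties as Finₚ
  using (toℕ-injective; toℕ<n; toℕ-fromℕ<; toℕ-fromℕ; toℕ-inject₁; all?; any?; splitAt-↑ˡ; splitAt-↑ʳ)
open import Data.Fin.Subset using (Subset; _∈_; _∉_; _⊆_; _⊈_; ∁; ∣_∣; ⊤; inside; outside)
open import Data.Fin.Subset.Properties
  using (_∈?_; x∈∁p⇒x∉p; x∉p⇒x∈∁p; x∈p⇒x∉∁p; anySubset?; ∣p∣≤n; ∣∁p∣≡n∸∣p∣; ∣p∣≡n⇒p≡⊤; ∈⊤)
open import Data.Bool as Bool using (Bool; true; false; not; _xor_; if_then_else_)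
open import Data.Bool.Properties using (not-¬; ¬-not; not-injective; not-involutive; not-distribˡ-xor)
open import Data.Vec as Vec using (Vec; []; _∷_; lookup; tabulate; removeAt; here; there)
open import Data.Vec.Properties using (lookup∘tabulate; []=⇒lookup; lookup⇒[]=; removeAt-punchOut)
open import Data.List as List using (List; []; _∷_; length; map)
open import Data.List.Properties using (map-cong-local; length-tabulate)
open import Data.List.Relation.Unary.All as All using (All; []; _∷_)
open import Data.List.Relation.Unary.AllPairs using (AllPairs; []; _∷_)
open import Data.List.Relation.Unary.AllPairs.Properties using (tabulate⁺-<)
open import Data.Product using (_×_; _,_; proj₁; proj₂; ∃; ∃-syntax)
open import Data.Sum using (_⊎_; inj₁; inj₂; [_,_]′)
open import Function using (_∘_)
open import Level using (Level)
open import Relation.Nullary using (¬_; Dec; yes; no; does; contradiction)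
open import Relation.Nullary.Decidable as Dec using (_×-dec_; _⊎-dec_; _→-dec_; ¬?; dec-true)
open import Relation.Unary using (Pred; Decidable)
open import Relation.Binary.PropositionalEquality
open import Algebra.Properties.CommutativeSemigroup *-commutativeSemigroup using (x∙yz≈y∙xz; xy∙z≈y∙xz)
open import Algebra.Properties.CommutativeMonoid.Sum +-0-commutativeMonoid
  using (sum-syntax; ∑-distrib-+; sum-cong-≗; sum-replicate-zero)

private variable
  ℓ : Level
  k n : ℕ

least : (P : ℕ → Set) → Decidable P → ∀ w → P w → ∃ (IsLeast P)
least P P? w pw with P? 0
... | yes p0 = 0 , p0 , λ _ _ → z≤n
least P P? zero pw | no ¬p0 = contradiction pw ¬p0
least P P? (suc w) pw | no ¬p0 with least (P ∘ suc) (P? ∘ suc) w pw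
... | k , pk , k-min = suc k , pk , λ where
  zero p0 → contradiction p0 ¬p0
  (suc j) pj → s≤s (k-min j pj)

IsLeast-⇔ : {P Q : ℕ → Set} → (∀ {k} → P k → Q k) → (∀ {k} → Q k → P k) →
            ∀ {k} → IsLeast P k → IsLeast Q k
IsLeast-⇔ P⇒Q Q⇒P (pk , k-min) = P⇒Q pk , λ j qj → k-min j (Q⇒P qj)

⟪_⟫ : {P : Pred (Fin n) ℓ} → Decidable P → Subset n
⟪ P? ⟫ = tabulate (does ∘ P?)

∈⟪⟫⁺ : {P : Pred (Fin n) ℓ} (P? : Decidable P) {i : Fin n} → P i → i ∈ ⟪ P? ⟫
∈⟪⟫⁺ P? {i} pi = lookup⇒[]= i _ (trans (lookup∘tabulate _ i) (dec-true (P? i) pi))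

∈⟪⟫⁻ : {P : Pred (Fin n) ℓ} (P? : Decidable P) {i : Fin n} → i ∈ ⟪ P? ⟫ → P i
∈⟪⟫⁻ P? {i} i∈ with P? i | trans (sym (lookup∘tabulate _ i)) ([]=⇒lookup i∈)
... | yes pi | _ = pi
... | no _ | ()

next : Fin n → Fin n
next {suc n} i with suc (toℕ i) ℕ.<? suc n
... | yes i+1<n = fromℕ< i+1<n
... | no _ = Fin.zero

prev : Fin n → Fin n
prev {suc n} Fin.zero = Fin.fromℕ n
prev {suc n} (Fin.suc i) = Fin.inject₁ i

Next-next : (i : Fin n) → Next n i (next i)
Next-next {suc n} i with suc (toℕ i) ℕ.<? suc n
... | yes i+1<n = inj₁ (sym (toℕ-fromℕ< i+1<n))
... | no i+1≮n = inj₂ (≤-antisym (toℕ<n i) (≮⇒≥ i+1≮n) , refl)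

Next-prev : (i : Fin n) → Next n (prev i) i
Next-prev {suc n} Fin.zero = inj₂ (cong suc (toℕ-fromℕ n) , refl)
Next-prev {suc n} (Fin.suc i) = inj₁ (cong suc (toℕ-inject₁ i))

Next-functional : {u v w : Fin n} → Next n u v → Next n u w → w ≡ v
Next-functional (inj₁ v≡u+1) (inj₁ w≡u+1) = toℕ-injective (trans (sym w≡u+1) v≡u+1)
Next-functional {v = v} (inj₁ v≡u+1) (inj₂ (u+1≡n , _)) =
  contradiction (trans (sym v≡u+1) u+1≡n) (<⇒≢ (toℕ<n v))
Next-functional {w = w} (inj₂ (u+1≡n , _)) (inj₁ w≡u+1) =
  contradiction (trans (sym w≡u+1) u+1≡n) (<⇒≢ (toℕ<n w))
Next-functional (inj₂ (_ , v≡0)) (inj₂ (_ , w≡0)) = toℕ-injective (trans w≡0 (sym v≡0))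

Next-asym : 3 ≤ n → {u v : Fin n} → Next n u v → ¬ Next n v u
Next-asym 3≤n = asym 3≤n
  where
  asym : ∀ {n a b} → 3 ≤ n → (suc a ≡ b) ⊎ (suc a ≡ n × b ≡ 0) →
         ¬ ((suc b ≡ a) ⊎ (suc b ≡ n × a ≡ 0))
  asym _ (inj₁ refl) (inj₁ a+2≡a) = m≢1+n+m _ (sym a+2≡a)
  asym (s≤s (s≤s ())) (inj₁ refl) (inj₂ (refl , refl))
  asym (s≤s (s≤s ())) (inj₂ (refl , refl)) (inj₁ refl)

Separates : (Fin k → Subset n) → Fin n → Fin n → Fin n → Set
Separates A u v x = ∃[ t ] (u ∈ A t × v ∈ A t × x ∉ A t)

IsCycleCovering : (Fin k → Subset n) → Set
IsCycleCovering {n = n} A =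
  ∀ u v → CycleEdge n u v → ∀ x → x ≢ u → x ≢ v → Separates A u v x

IsCycleCovering-fromNext : {A : Fin k → Subset n} →
  (∀ u v → Next n u v → ∀ x → x ≢ u → x ≢ v → Separates A u v x) →
  IsCycleCovering A
IsCycleCovering-fromNext sep u v (inj₁ u→v) x x≢u x≢v = sep u v u→v x x≢u x≢v
IsCycleCovering-fromNext sep u v (inj₂ v→u) x x≢u x≢v with sep v u v→u x x≢v x≢u
... | t , v∈ , u∈ , x∉ = t , u∈ , v∈ , x∉

cycleCovering⇒bicliqueCover : CycleCovering n k → BicliqueCover n k
cycleCovering⇒bicliqueCover {n} (A , cover) = L , ∁ ∘ A , biclique , covered
  where
  edgeIn? : ∀ t → Decidable (λ i → i ∈ A t × next i ∈ A t)
  edgeIn? t i = (i ∈? A t) ×-dec (next i ∈? A t)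
  L : _ → Subset n
  L t = ⟪ edgeIn? t ⟫
  biclique : ∀ t → IsBiclique n (L t) (∁ (A t))
  biclique t i j i∈L j∈∁A =
      (λ { refl → j∉A i∈A })
    , (λ i→j → j∉A (subst (_∈ A t) (Next-functional i→j (Next-next i)) i+1∈A))
    where
    i∈A = proj₁ (∈⟪⟫⁻ (edgeIn? t) i∈L)
    i+1∈A = proj₂ (∈⟪⟫⁻ (edgeIn? t) i∈L)
    j∉A = x∈∁p⇒x∉p j∈∁A
  covered : ∀ i j → KnnMinusC2nEdge n i j → ∃[ t ] (i ∈ L t × j ∈ ∁ (A t))
  covered i j (i≢j , i↛j) with cover i (next i) (inj₁ (Next-next i)) j (i≢j ∘ sym)
                                 (λ { refl → i↛j (Next-next i) })
  ... | t , i∈ , i+1∈ , j∉ = t , ∈⟪⟫⁺ (edgeIn? t) (i∈ , i+1∈) , x∉p⇒x∈∁p j∉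

bicliqueCover⇒cycleCovering : BicliqueCover n k → CycleCovering n k
bicliqueCover⇒cycleCovering {n} (A , B , biclique , cover) =
  ∁ ∘ B , IsCycleCovering-fromNext separate
  where
  separate : ∀ u v → Next n u v → ∀ x → x ≢ u → x ≢ v → Separates (∁ ∘ B) u v x
  separate u v u→v x x≢u x≢v with cover u x (x≢u ∘ sym , x≢v ∘ Next-functional u→v)
  ... | t , u∈A , x∈B =
      t
    , x∉p⇒x∈∁p (λ u∈B → proj₁ (biclique t u u u∈A u∈B) refl)
    , x∉p⇒x∈∁p (λ v∈B → proj₂ (biclique t u v u∈A v∈B) u→v)
    , x∈p⇒x∉∁p x∈B

Next? : ∀ n → (u v : Fin n) → Dec (Next n u v)
Next? n u v = (suc (toℕ u) ℕ.≟ toℕ v) ⊎-dec ((suc (toℕ u) ℕ.≟ n) ×-dec (toℕ v ℕ.≟ 0))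

IsCycleCovering? : (A : Fin k → Subset n) → Dec (IsCycleCovering A)
IsCycleCovering? {n = n} A =
  all? λ u → all? λ v → (Next? n u v ⊎-dec Next? n v u) →-dec
  all? λ x → ¬? (x Finₚ.≟ u) →-dec ¬? (x Finₚ.≟ v) →-dec
  any? λ t → (u ∈? A t) ×-dec (v ∈? A t) ×-dec ¬? (x ∈? A t)

IsCycleCovering-≗ : {A B : Fin k → Subset n} → (∀ t → A t ≡ B t) →
                    IsCycleCovering A → IsCycleCovering B
IsCycleCovering-≗ A≗B cover u v e x x≢u x≢v with cover u v e x x≢u x≢v
... | t , u∈ , v∈ , x∉ rewrite A≗B t = t , u∈ , v∈ , x∉

anyVec? : ∀ k {P : Pred (Vec (Subset n) k) ℓ} → Decidable P → Dec (∃ P)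
anyVec? zero P? = Dec.map′ ([] ,_) (λ { ([] , p) → p }) (P? [])
anyVec? (suc k) P? =
  Dec.map′ (λ (a , as , p) → a ∷ as , p) (λ { (a ∷ as , p) → a , as , p })
           (anySubset? λ a → anyVec? k (P? ∘ (a ∷_)))

CycleCovering? : ∀ n k → Dec (CycleCovering n k)
CycleCovering? n k =
  Dec.map′ (λ (V , cover) → lookup V , cover)
           (λ (A , cover) → tabulate A , IsCycleCovering-≗ (λ t → sym (lookup∘tabulate A t)) cover)
           (anyVec? k (IsCycleCovering? ∘ lookup))

⌊a+[a+d]/2⌋≡a+⌊d/2⌋ : ∀ a d → ⌊ a + (a + d) /2⌋ ≡ a + ⌊ d /2⌋
⌊a+[a+d]/2⌋≡a+⌊d/2⌋ zero d = refl
⌊a+[a+d]/2⌋≡a+⌊d/2⌋ (suc a) d =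
  trans (cong (λ m → ⌊ suc m /2⌋) (+-suc a (a + d))) (cong suc (⌊a+[a+d]/2⌋≡a+⌊d/2⌋ a d))

⌈a+[a+d]/2⌉≡a+⌈d/2⌉ : ∀ a d → ⌈ a + (a + d) /2⌉ ≡ a + ⌈ d /2⌉
⌈a+[a+d]/2⌉≡a+⌈d/2⌉ zero d = refl
⌈a+[a+d]/2⌉≡a+⌈d/2⌉ (suc a) d =
  trans (cong (λ m → ⌈ suc m /2⌉) (+-suc a (a + d))) (cong suc (⌈a+[a+d]/2⌉≡a+⌈d/2⌉ a d))

Incomparable : Subset n → Subset n → Set
Incomparable p q = p ⊈ q × q ⊈ p

Antichain : List (Subset n) → Set
Antichain = AllPairs Incomparable

∣p∣+∣∁p∣≡n : (p : Subset n) → ∣ p ∣ + ∣ ∁ p ∣ ≡ n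
∣p∣+∣∁p∣≡n p = trans (cong (∣ p ∣ +_) (∣∁p∣≡n∸∣p∣ p)) (m+[n∸m]≡n (∣p∣≤n p))

⊈⇒∣∁p∣≡1+ : {p q : Subset n} → q ⊈ p → ∃ λ z → ∣ ∁ p ∣ ≡ suc z
⊈⇒∣∁p∣≡1+ {p = p} q⊈p with ∣ ∁ p ∣ in ∣∁p∣≡
... | suc z = z , refl
... | zero = contradiction (λ {x} _ → subst (x ∈_) (sym p≡⊤) ∈⊤) q⊈p
  where
  p≡⊤ : p ≡ ⊤
  p≡⊤ = ∣p∣≡n⇒p≡⊤ (≤-antisym (∣p∣≤n p) (m∸n≡0⇒m≤n (trans (sym (∣∁p∣≡n∸∣p∣ p)) ∣∁p∣≡)))

∣removeAt∣ : (p : Subset (suc n)) {x : Fin (suc n)} → x ∉ p → ∣ removeAt p x ∣ ≡ ∣ p ∣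
∣removeAt∣ (inside ∷ p) {Fin.zero} x∉p = contradiction here x∉p
∣removeAt∣ (outside ∷ p) {Fin.zero} x∉p = refl
∣removeAt∣ (inside ∷ p@(_ ∷ _)) {Fin.suc x} x∉p = cong suc (∣removeAt∣ p (x∉p ∘ there))
∣removeAt∣ (outside ∷ p@(_ ∷ _)) {Fin.suc x} x∉p = ∣removeAt∣ p (x∉p ∘ there)

∣∁removeAt∣ : (p : Subset (suc n)) {x : Fin (suc n)} → x ∉ p →
              suc ∣ ∁ (removeAt p x) ∣ ≡ ∣ ∁ p ∣
∣∁removeAt∣ (inside ∷ p) {Fin.zero} x∉p = contradiction here x∉p
∣∁removeAt∣ (outside ∷ p) {Fin.zero} x∉p = refl
∣∁removeAt∣ (inside ∷ p@(_ ∷ _)) {Fin.suc x} x∉p = ∣∁removeAt∣ p (x∉p ∘ there)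
∣∁removeAt∣ (outside ∷ p@(_ ∷ _)) {Fin.suc x} x∉p = cong suc (∣∁removeAt∣ p (x∉p ∘ there))

removeAt-⊆⁻ : (p q : Subset (suc n)) {x : Fin (suc n)} → x ∉ p →
              removeAt p x ⊆ removeAt q x → p ⊆ q
removeAt-⊆⁻ p q {x} x∉p p∖x⊆q∖x {y} y∈p =
  lookup⇒[]= y q (trans (sym (removeAt-punchOut q x≢y))
    ([]=⇒lookup (p∖x⊆q∖x (lookup⇒[]= _ _ (trans (removeAt-punchOut p x≢y) ([]=⇒lookup y∈p))))))
  where
  x≢y : x ≢ y
  x≢y refl = x∉p y∈p

Incomparable-removeAt : {p q : Subset (suc n)} {x : Fin (suc n)} → x ∉ p → x ∉ q →
  Incomparable p q → Incomparable (removeAt p x) (removeAt q x)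
Incomparable-removeAt x∉p x∉q (p⊈q , q⊈p) =
  p⊈q ∘ removeAt-⊆⁻ _ _ x∉p , q⊈p ∘ removeAt-⊆⁻ _ _ x∉q

restrict : Fin (suc n) → List (Subset (suc n)) → List (Subset n)
restrict x [] = []
restrict x (p ∷ F) with x ∈? p
... | yes _ = restrict x F
... | no _ = removeAt p x ∷ restrict x F

restrict-antichain : (x : Fin (suc n)) {F : List (Subset (suc n))} →
                     Antichain F → Antichain (restrict x F)
restrict-antichain x [] = []
restrict-antichain x {p ∷ F} (p∥F ∷ F-antichain) with x ∈? p
... | yes _ = restrict-antichain x F-antichain
... | no x∉p = restrict-all p∥F ∷ restrict-antichain x F-antichain
  where
  restrict-all : ∀ {G} → All (Incomparable p) G → All (Incomparable (removeAt p x)) (restrict x G)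
  restrict-all [] = []
  restrict-all {q ∷ G} (p∥q ∷ p∥G) with x ∈? q
  ... | yes _ = restrict-all p∥G
  ... | no x∉q = Incomparable-removeAt x∉p x∉q p∥q ∷ restrict-all p∥G

-- weight p counts the maximal chains ∅ ⊂ … ⊂ [n] passing through p.
weight : Subset n → ℕ
weight p = ∣ p ∣ ! * ∣ ∁ p ∣ !

restrictedWeight : Subset (suc n) → Fin (suc n) → ℕ
restrictedWeight p x with x ∈? p
... | yes _ = 0
... | no _ = weight (removeAt p x)

sum-restrictedWeight : (x : Fin (suc n)) (F : List (Subset (suc n))) →
  sum (map (λ p → restrictedWeight p x) F) ≡ sum (map weight (restrict x F))
sum-restrictedWeight x [] = refl
sum-restrictedWeight x (p ∷ F) with x ∈? p
... | yes _ = sum-restrictedWeight x F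
... | no _ = cong (weight (removeAt p x) +_) (sum-restrictedWeight x F)

∑-∉ : (p : Subset n) (c : ℕ) → ∑[ x < n ] (if does (x ∈? p) then 0 else c) ≡ ∣ ∁ p ∣ * c
∑-∉ [] c = refl
∑-∉ (inside ∷ p) c = ∑-∉ p c
∑-∉ (outside ∷ p) c = cong (c +_) (∑-∉ p c)

-- Sorting the chains through p by the first point they add to p.
∑-restrictedWeight : (p : Subset (suc n)) {q : Subset (suc n)} → q ⊈ p →
                     ∑[ x < suc n ] restrictedWeight p x ≡ weight p
∑-restrictedWeight p q⊈p with ⊈⇒∣∁p∣≡1+ q⊈p
... | z , ∣∁p∣≡1+z = begin
  ∑[ x < _ ] restrictedWeight p x                        ≡⟨ sum-cong-≗ indicator ⟩
  ∑[ x < _ ] (if does (x ∈? p) then 0 else ∣ p ∣ ! * z !) ≡⟨ ∑-∉ p _ ⟩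
  ∣ ∁ p ∣ * (∣ p ∣ ! * z !)                               ≡⟨ cong (_* (∣ p ∣ ! * z !)) ∣∁p∣≡1+z ⟩
  suc z * (∣ p ∣ ! * z !)                                 ≡⟨ x∙yz≈y∙xz (suc z) (∣ p ∣ !) (z !) ⟩
  ∣ p ∣ ! * (suc z) !                                     ≡⟨ cong (λ c → ∣ p ∣ ! * c !) ∣∁p∣≡1+z ⟨
  weight p                                                ∎
  where
  open ≡-Reasoning
  indicator : ∀ x → restrictedWeight p x ≡ (if does (x ∈? p) then 0 else ∣ p ∣ ! * z !)
  indicator x with x ∈? p
  ... | yes _ = refl
  ... | no x∉p = cong₂ (λ a b → a ! * b !) (∣removeAt∣ p x∉p)
                       (suc-injective (trans (∣∁removeAt∣ p x∉p) ∣∁p∣≡1+z))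

sum-map-∑ : ∀ {A : Set} (h : A → Fin n → ℕ) (F : List A) →
  sum (map (λ a → ∑[ x < n ] h a x) F) ≡ ∑[ x < n ] sum (map (λ a → h a x) F)
sum-map-∑ {n} h [] = sym (sum-replicate-zero n)
sum-map-∑ h (a ∷ F) =
  trans (cong (∑[ x < _ ] h a x +_) (sum-map-∑ h F)) (sym (∑-distrib-+ (h a) _))

∑-≤ : (f : Fin n → ℕ) {c : ℕ} → (∀ x → f x ≤ c) → ∑[ x < n ] f x ≤ n * c
∑-≤ {zero} f f≤c = z≤n
∑-≤ {suc n} f f≤c = +-mono-≤ (f≤c Fin.zero) (∑-≤ (f ∘ Fin.suc) (f≤c ∘ Fin.suc))

m!*n!≤[m+n]! : ∀ m n → m ! * n ! ≤ (m + n) !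
m!*n!≤[m+n]! m n = ∣⇒≤ {{(m + n) !≢0}}
  (subst (λ k → m ! * k ! ∣ (m + n) !) (m+n∸m≡n m n) (k![n∸k]!∣n! (m≤m+n m n)))

-- The LYM inequality, multiplied through by n!.
lym : ∀ n (F : List (Subset n)) → Antichain F → sum (map weight F) ≤ n !
lym n [] _ = z≤n
lym n (p ∷ []) _ = begin
  weight p + 0              ≡⟨ +-identityʳ (weight p) ⟩
  ∣ p ∣ ! * ∣ ∁ p ∣ !       ≤⟨ m!*n!≤[m+n]! ∣ p ∣ ∣ ∁ p ∣ ⟩
  (∣ p ∣ + ∣ ∁ p ∣) !       ≡⟨ cong _! (∣p∣+∣∁p∣≡n p) ⟩
  n !                       ∎
  where open ≤-Reasoning
lym zero (p ∷ q ∷ F) (((p⊈q , _) ∷ _) ∷ _) = contradiction (λ { {()} }) p⊈q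
lym (suc n) F@(p ∷ q ∷ G) F-antichain@(((p⊈q , q⊈p) ∷ p∥G) ∷ _) = begin
  sum (map weight F)                                       ≡⟨ split-weights ⟩
  sum (map (λ r → ∑[ x < suc n ] restrictedWeight r x) F)  ≡⟨ sum-map-∑ restrictedWeight F ⟩
  ∑[ x < suc n ] sum (map (λ r → restrictedWeight r x) F)  ≡⟨ sum-cong-≗ (λ x → sum-restrictedWeight x F) ⟩
  ∑[ x < suc n ] sum (map weight (restrict x F))           ≤⟨ ∑-≤ _ restricted-lym ⟩
  suc n * n !                                              ∎
  where
  open ≤-Reasoning
  notFull : All (λ r → ∃ (_⊈ r)) F
  notFull = (q , q⊈p) ∷ (p , p⊈q) ∷ All.map (λ (p⊈r , _) → p , p⊈r) p∥G
  split-weights : sum (map weight F) ≡ sum (map (λ r → ∑[ x < suc n ] restrictedWeight r x) F)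
  split-weights = cong sum (map-cong-local
    (All.map (λ (_ , q⊈r) → sym (∑-restrictedWeight _ q⊈r)) notFull))
  restricted-lym : ∀ x → sum (map weight (restrict x F)) ≤ n !
  restricted-lym x = lym n (restrict x F) (restrict-antichain x F-antichain)

-- Moving a and a + d one step towards each other can only decrease a! (a + d)!.
balanced-factorials : ∀ a d → (a + ⌊ d /2⌋) ! * (a + ⌈ d /2⌉) ! ≤ a ! * (a + d) !
balanced-factorials a zero rewrite +-identityʳ a = ≤-refl
balanced-factorials a (suc zero) rewrite +-identityʳ a = ≤-refl
balanced-factorials a (suc (suc d)) = begin
  (a + suc ⌊ d /2⌋) ! * (a + suc ⌈ d /2⌉) !  ≡⟨ cong₂ (λ x y → x ! * y !) (+-suc a _) (+-suc a _) ⟩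
  (suc a + ⌊ d /2⌋) ! * (suc a + ⌈ d /2⌉) !  ≤⟨ balanced-factorials (suc a) d ⟩
  suc a * a ! * (suc a + d) !                 ≤⟨ *-monoˡ-≤ ((suc a + d) !) (*-monoˡ-≤ (a !) a+1≤a+d+2) ⟩
  suc (suc (a + d)) * a ! * (suc a + d) !     ≡⟨ xy∙z≈y∙xz (suc (suc (a + d))) (a !) _ ⟩
  a ! * (suc (suc (a + d))) !                 ≡⟨ cong (λ x → a ! * x !) a+[d+2]≡a+d+2 ⟨
  a ! * (a + suc (suc d)) !                   ∎
  where
  open ≤-Reasoning
  a+1≤a+d+2 : suc a ≤ suc (suc (a + d))
  a+1≤a+d+2 = s≤s (m≤n⇒m≤1+n (m≤m+n a d))
  a+[d+2]≡a+d+2 : a + suc (suc d) ≡ suc (suc (a + d))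
  a+[d+2]≡a+d+2 = trans (+-suc a (suc d)) (cong suc (+-suc a d))

⌊a+b/2⌋!*⌈a+b/2⌉!≤a!*b! : ∀ a b → ⌊ a + b /2⌋ ! * ⌈ a + b /2⌉ ! ≤ a ! * b !
⌊a+b/2⌋!*⌈a+b/2⌉!≤a!*b! a b = [ ordered , swapped ]′ (≤-total a b)
  where
  ordered : ∀ {a b} → a ≤ b → ⌊ a + b /2⌋ ! * ⌈ a + b /2⌉ ! ≤ a ! * b !
  ordered {a} a≤b with d , refl ← m≤n⇒∃[o]m+o≡n a≤b
    rewrite ⌊a+[a+d]/2⌋≡a+⌊d/2⌋ a d | ⌈a+[a+d]/2⌉≡a+⌈d/2⌉ a d = balanced-factorials a d
  swapped : b ≤ a → ⌊ a + b /2⌋ ! * ⌈ a + b /2⌉ ! ≤ a ! * b !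
  swapped b≤a =
    subst₂ (λ s p → ⌊ s /2⌋ ! * ⌈ s /2⌉ ! ≤ p) (+-comm b a) (*-comm (b !) (a !)) (ordered b≤a)

n∸⌊n/2⌋≡⌈n/2⌉ : ∀ n → n ∸ ⌊ n /2⌋ ≡ ⌈ n /2⌉
n∸⌊n/2⌋≡⌈n/2⌉ n = trans (cong (_∸ ⌊ n /2⌋) (sym (⌊n/2⌋+⌈n/2⌉≡n n))) (m+n∸m≡n ⌊ n /2⌋ _)

nCk*k!*[n∸k]!≡n! : ∀ {n k} → k ≤ n → (n C k) * (k ! * (n ∸ k) !) ≡ n !
nCk*k!*[n∸k]!≡n! {n} {k} k≤n =
  trans (cong (_* (k ! * (n ∸ k) !)) (nCk≡n!/k![n-k]! k≤n))
        (m/n*n≡m {{k !* (n ∸ k) !≢0}} (k![n∸k]!∣n! k≤n))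

sperner : ∀ n (F : List (Subset n)) → Antichain F → length F ≤ n C ⌊ n /2⌋
sperner n F F-antichain =
  *-cancelʳ-≤ (length F) (n C ⌊ n /2⌋) middleWeight {{⌊ n /2⌋ !* ⌈ n /2⌉ !≢0}} (begin
    length F * middleWeight     ≤⟨ middleWeight-≤ F ⟩
    sum (map weight F)          ≤⟨ lym n F F-antichain ⟩
    n !                         ≡⟨ sym (nCk*k!*[n∸k]!≡n! (⌊n/2⌋≤n n)) ⟩
    (n C ⌊ n /2⌋) * (⌊ n /2⌋ ! * (n ∸ ⌊ n /2⌋) !)
      ≡⟨ cong (λ c → (n C ⌊ n /2⌋) * (⌊ n /2⌋ ! * c !)) (n∸⌊n/2⌋≡⌈n/2⌉ n) ⟩
    (n C ⌊ n /2⌋) * middleWeight  ∎)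
  where
  open ≤-Reasoning
  middleWeight = ⌊ n /2⌋ ! * ⌈ n /2⌉ !
  middleWeight≤weight : (p : Subset n) → middleWeight ≤ weight p
  middleWeight≤weight p = subst (λ m → ⌊ m /2⌋ ! * ⌈ m /2⌉ ! ≤ weight p) (∣p∣+∣∁p∣≡n p)
    (⌊a+b/2⌋!*⌈a+b/2⌉!≤a!*b! ∣ p ∣ ∣ ∁ p ∣)
  middleWeight-≤ : ∀ G → length G * middleWeight ≤ sum (map weight G)
  middleWeight-≤ [] = z≤n
  middleWeight-≤ (p ∷ G) = +-mono-≤ (middleWeight≤weight p) (middleWeight-≤ G)

neighbour-avoiding : 3 ≤ n → (y z : Fin n) → ∃[ w ] (CycleEdge n y w × z ≢ w)
neighbour-avoiding {n} 3≤n y z with z Finₚ.≟ next y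
... | no z≢next = next y , inj₁ (Next-next y) , z≢next
... | yes refl = prev y , inj₂ (Next-prev y) , λ next≡prev →
  Next-asym 3≤n (Next-next y) (subst (λ w → Next n w y) (sym next≡prev) (Next-prev y))

signature : (Fin k → Subset n) → Fin n → Subset k
signature A y = ⟪ (λ t → y ∈? A t) ⟫

signature-⊈ : 3 ≤ n → {A : Fin k → Subset n} → IsCycleCovering A →
              {y z : Fin n} → y ≢ z → signature A y ⊈ signature A z
signature-⊈ 3≤n {A} cover {y} {z} y≢z sig-y⊆sig-z
  with w , y~w , z≢w ← neighbour-avoiding 3≤n y z
  with t , y∈ , _ , z∉ ← cover y w y~w z (y≢z ∘ sym) z≢w
  = z∉ (∈⟪⟫⁻ (λ t → z ∈? A t) (sig-y⊆sig-z (∈⟪⟫⁺ (λ t → y ∈? A t) y∈)))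

cycleCovering⇒n≤kC⌊k/2⌋ : 3 ≤ n → CycleCovering n k → n ≤ k C ⌊ k /2⌋
cycleCovering⇒n≤kC⌊k/2⌋ {n} {k} 3≤n (A , cover) =
  subst (_≤ k C ⌊ k /2⌋) (length-tabulate (signature A))
    (sperner k (List.tabulate (signature A)) (tabulate⁺-< λ i<j →
      signature-⊈ 3≤n cover (Finₚ.<⇒≢ i<j) , signature-⊈ 3≤n cover (Finₚ.<⇒≢ i<j ∘ sym)))

lsb : ℕ → Bool
lsb zero = false
lsb (suc zero) = true
lsb (suc (suc m)) = lsb m

bit : ℕ → ℕ → Bool
bit m zero = lsb m
bit m (suc b) = bit ⌊ m /2⌋ b

-- Bit b of the binary reflected Gray code m xor ⌊m/2⌋; note that
-- gray m (1 + b) reduces to gray ⌊m/2⌋ b.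
gray : ℕ → ℕ → Bool
gray m b = bit m b xor bit m (suc b)

lsb-suc : ∀ m → lsb (suc m) ≡ not (lsb m)
lsb-suc zero = refl
lsb-suc (suc zero) = refl
lsb-suc (suc (suc m)) = lsb-suc m

⌊1+m/2⌋-even : ∀ {m} → lsb m ≡ false → ⌊ suc m /2⌋ ≡ ⌊ m /2⌋
⌊1+m/2⌋-even {zero} _ = refl
⌊1+m/2⌋-even {suc (suc m)} even = cong suc (⌊1+m/2⌋-even even)

⌊1+m/2⌋-odd : ∀ {m} → lsb m ≡ true → ⌊ suc m /2⌋ ≡ suc ⌊ m /2⌋
⌊1+m/2⌋-odd {suc zero} _ = refl
⌊1+m/2⌋-odd {suc (suc m)} odd = cong suc (⌊1+m/2⌋-odd odd)

lsb-⌊/2⌋-injective : ∀ {x y} → lsb x ≡ lsb y → ⌊ x /2⌋ ≡ ⌊ y /2⌋ → x ≡ y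
lsb-⌊/2⌋-injective {zero} {zero} _ _ = refl
lsb-⌊/2⌋-injective {zero} {suc zero} () _
lsb-⌊/2⌋-injective {suc zero} {zero} () _
lsb-⌊/2⌋-injective {suc zero} {suc zero} _ _ = refl
lsb-⌊/2⌋-injective {suc (suc x)} {suc (suc y)} lsb≡ ⌊/2⌋≡ =
  cong (suc ∘ suc) (lsb-⌊/2⌋-injective lsb≡ (suc-injective ⌊/2⌋≡))

⌊x/2⌋<2^L : ∀ L {x} → x < 2 ^ suc L → ⌊ x /2⌋ < 2 ^ L
⌊x/2⌋<2^L L x<2^[1+L] = ≤-trans (⌊n/2⌋-mono (s≤s x<2^[1+L]))
  (≤-reflexive (trans (⌈a+[a+d]/2⌉≡a+⌈d/2⌉ (2 ^ L) 0) (+-identityʳ (2 ^ L))))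

GrayStep : ℕ → Set
GrayStep m = ∃[ c ] (gray m c ≢ gray (suc m) c × ∀ b → b ≢ c → gray m b ≡ gray (suc m) b)

not-xor-not : ∀ x y → not x xor not y ≡ x xor y
not-xor-not true y = refl
not-xor-not false y = not-involutive y

gray-step-even : ∀ {m} → lsb m ≡ false → GrayStep m
gray-step-even {m} even = 0 , differ , same
  where
  flips : gray (suc m) 0 ≡ not (gray m 0)
  flips = trans (cong₂ _xor_ (lsb-suc m) (cong lsb (⌊1+m/2⌋-even {m} even)))
                (sym (not-distribˡ-xor (lsb m) _))
  differ : gray m 0 ≢ gray (suc m) 0
  differ same0 = not-¬ refl (trans same0 flips)
  same : ∀ b → b ≢ 0 → gray m b ≡ gray (suc m) b
  same zero b≢0 = contradiction refl b≢0
  same (suc b) _ = cong (λ h → gray h b) (sym (⌊1+m/2⌋-even even))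

gray-step-odd : ∀ {m} → lsb m ≡ true → GrayStep ⌊ m /2⌋ → GrayStep m
gray-step-odd {m} odd (c , differ , same) = suc c , differ′ , same′
  where
  ⌊1+m/2⌋≡ = ⌊1+m/2⌋-odd odd
  differ′ : gray m (suc c) ≢ gray (suc m) (suc c)
  differ′ = subst (λ h → gray ⌊ m /2⌋ c ≢ gray h c) (sym ⌊1+m/2⌋≡) differ
  same′ : ∀ b → b ≢ suc c → gray m b ≡ gray (suc m) b
  same′ zero _ = sym (begin
    lsb (suc m) xor lsb ⌊ suc m /2⌋    ≡⟨ cong₂ _xor_ (lsb-suc m) (trans (cong lsb ⌊1+m/2⌋≡) (lsb-suc ⌊ m /2⌋)) ⟩
    not (lsb m) xor not (lsb ⌊ m /2⌋)  ≡⟨ not-xor-not (lsb m) _ ⟩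
    lsb m xor lsb ⌊ m /2⌋              ∎)
    where open ≡-Reasoning
  same′ (suc b) b≢1+c = trans (same b (b≢1+c ∘ cong suc)) (cong (λ h → gray h b) (sym ⌊1+m/2⌋≡))

gray-step : ∀ m → GrayStep m
gray-step = <-rec GrayStep step
  where
  step : ∀ m → (∀ {h} → h < m → GrayStep h) → GrayStep m
  step zero _ = gray-step-even refl
  step (suc m) rec with lsb (suc m) in lsb≡
  ... | false = gray-step-even lsb≡
  ... | true = gray-step-odd lsb≡ (rec (⌊n/2⌋<n m))

xor-cancelʳ : ∀ x y {z} → x xor z ≡ y xor z → x ≡ y
xor-cancelʳ true true _ = refl
xor-cancelʳ false false _ = refl
xor-cancelʳ true false e = contradiction (sym e) (not-¬ refl)
xor-cancelʳ false true e = contradiction e (not-¬ refl)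

gray-injective : ∀ L {x y} → x < 2 ^ L → y < 2 ^ L → x ≢ y →
                 ∃[ b ] gray x (toℕ {L} b) ≢ gray y (toℕ b)
gray-injective zero {zero} {zero} _ _ x≢y = contradiction refl x≢y
gray-injective zero {suc _} (s≤s ()) _ _
gray-injective zero {y = suc _} _ (s≤s ()) _
gray-injective (suc L) {x} {y} x< y< x≢y with ⌊ x /2⌋ ≟ ⌊ y /2⌋
... | no ⌊x/2⌋≢⌊y/2⌋ =
  let b , differ = gray-injective L (⌊x/2⌋<2^L L x<) (⌊x/2⌋<2^L L y<) ⌊x/2⌋≢⌊y/2⌋
  in Fin.suc b , differ
... | yes ⌊x/2⌋≡⌊y/2⌋ = Fin.zero , λ same0 →
  x≢y (lsb-⌊/2⌋-injective (xor-cancelʳ (lsb x) (lsb y)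
        (trans same0 (cong (λ h → lsb y xor lsb h) (sym ⌊x/2⌋≡⌊y/2⌋)))) ⌊x/2⌋≡⌊y/2⌋)

-- Some bit on which i and 1 + i agree tells x apart: the bit c flipped by
-- the Gray step cannot separate x from both, as there are only two values.
gray-separates : ∀ L {i x} → suc i < 2 ^ L → x < 2 ^ L → x ≢ i → x ≢ suc i →
  ∃[ b ] (gray i (toℕ {L} b) ≡ gray (suc i) (toℕ b) × gray x (toℕ b) ≢ gray i (toℕ b))
gray-separates L {i} {x} 1+i< x< x≢i x≢1+i
  with c , flipped , kept ← gray-step i
     | b , x≠i ← gray-injective L x< (<⇒≤ 1+i<) x≢i
     | b′ , x≠1+i ← gray-injective L x< 1+i< x≢1+i
  with toℕ b ≟ c | toℕ b′ ≟ c
... | no b≢c | _ = b , kept _ b≢c , x≠i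
... | yes _ | no b′≢c = b′ , kept _ b′≢c , x≠1+i ∘ (λ e → trans e (kept _ b′≢c))
... | yes refl | yes b′≡c =
  contradiction (not-injective (trans (sym (¬-not x≠i))
                  (subst (λ d → gray x d ≡ not (gray (suc i) d)) b′≡c (¬-not x≠1+i)))) flipped

n≤2^⌈log₂n⌉ : ∀ n → n ≤ 2 ^ ⌈log₂ n ⌉
n≤2^⌈log₂n⌉ = <-rec _ step
  where
  step : ∀ n → (∀ {m} → m < n → m ≤ 2 ^ ⌈log₂ m ⌉) → n ≤ 2 ^ ⌈log₂ n ⌉
  step zero _ = z≤n
  step (suc zero) _ = s≤s z≤n
  step n@(suc (suc m)) rec = begin
    n                                 ≡⟨ ⌊n/2⌋+⌈n/2⌉≡n n ⟨
    ⌊ n /2⌋ + ⌈ n /2⌉                 ≤⟨ +-monoˡ-≤ ⌈ n /2⌉ (⌊n/2⌋≤⌈n/2⌉ n) ⟩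
    ⌈ n /2⌉ + ⌈ n /2⌉                 ≤⟨ +-mono-≤ half≤ (≤-trans half≤ (m≤m+n _ 0)) ⟩
    2 ^ suc ⌈log₂ ⌈ n /2⌉ ⌉           ≡⟨ cong (λ k → 2 ^ suc k) (⌈log₂⌈n/2⌉⌉≡⌈log₂n⌉∸1 n) ⟩
    2 ^ suc (⌈log₂ n ⌉ ∸ 1)           ≡⟨ cong (2 ^_) (m+[n∸m]≡n 1≤⌈log₂n⌉) ⟩
    2 ^ ⌈log₂ n ⌉                     ∎
    where
    open ≤-Reasoning
    1≤⌈log₂n⌉ : 1 ≤ ⌈log₂ n ⌉
    1≤⌈log₂n⌉ = ⌈log₂⌉-mono-≤ {2} {n} (s≤s (s≤s z≤n))
    half≤ : ⌈ n /2⌉ ≤ 2 ^ ⌈log₂ ⌈ n /2⌉ ⌉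
    half≤ = rec (⌈n/2⌉<n m)

isEnd? : (y : Fin n) → Dec (toℕ y ≡ 0 ⊎ suc (toℕ y) ≡ n)
isEnd? {n} y = (toℕ y ℕ.≟ 0) ⊎-dec (suc (toℕ y) ℕ.≟ n)

hasGrayBit? : ∀ {L} (b : Fin L) (β : Bool) (y : Fin n) → Dec (gray (toℕ y) (toℕ b) ≡ β)
hasGrayBit? b β y = gray (toℕ y) (toℕ b) Bool.≟ β

bitSet : ∀ {L} → Bool → Fin L → Subset n
bitSet β b = ⟪ hasGrayBit? b β ⟫

grayFamily : ∀ n → Fin (suc (⌈log₂ n ⌉ + ⌈log₂ n ⌉)) → Subset n
grayFamily n Fin.zero = ⟪ isEnd? ⟫
grayFamily n (Fin.suc t) = [ bitSet false , bitSet true ]′ (splitAt ⌈log₂ n ⌉ t)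

grayFamily-bitSet : ∀ n β (b : Fin ⌈log₂ n ⌉) → ∃[ t ] grayFamily n t ≡ bitSet β b
grayFamily-bitSet n false b =
  Fin.suc (b ↑ˡ _) , cong [ bitSet false , bitSet true ]′ (splitAt-↑ˡ _ b _)
grayFamily-bitSet n true b =
  Fin.suc (_ ↑ʳ b) , cong [ bitSet false , bitSet true ]′ (splitAt-↑ʳ ⌈log₂ n ⌉ _ b)

grayCovering : ∀ n → CycleCovering n (suc (⌈log₂ n ⌉ + ⌈log₂ n ⌉))
grayCovering n = grayFamily n , IsCycleCovering-fromNext separate
  where
  L = ⌈log₂ n ⌉
  <2^L : (y : Fin n) → toℕ y < 2 ^ L
  <2^L y = <-≤-trans (toℕ<n y) (n≤2^⌈log₂n⌉ n)
  separate : ∀ u v → Next n u v → ∀ x → x ≢ u → x ≢ v → Separates (grayFamily n) u v x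
  separate u v (inj₂ (u+1≡n , v≡0)) x x≢u x≢v =
    Fin.zero , ∈⟪⟫⁺ isEnd? (inj₂ u+1≡n) , ∈⟪⟫⁺ isEnd? (inj₁ v≡0) , [ x≢v′ , x≢u′ ]′ ∘ ∈⟪⟫⁻ isEnd?
    where
    x≢v′ : toℕ x ≢ 0
    x≢v′ x≡0 = x≢v (toℕ-injective (trans x≡0 (sym v≡0)))
    x≢u′ : suc (toℕ x) ≢ n
    x≢u′ x+1≡n = x≢u (toℕ-injective (suc-injective (trans x+1≡n (sym u+1≡n))))
  separate u v (inj₁ u+1≡v) x x≢u x≢v
    with b , kept , x≠u ← gray-separates L (subst (_< 2 ^ L) (sym u+1≡v) (<2^L v)) (<2^L x)
                            (x≢u ∘ toℕ-injective) (x≢v ∘ toℕ-injective ∘ (λ e → trans e u+1≡v))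
    with t , t≡ ← grayFamily-bitSet n (gray (toℕ u) (toℕ b)) b
    = t , subst (u ∈_) (sym t≡) (∈⟪⟫⁺ (hasGrayBit? b _) refl)
        , subst (v ∈_) (sym t≡) (∈⟪⟫⁺ (hasGrayBit? b _) v-bit)
        , x≠u ∘ ∈⟪⟫⁻ (hasGrayBit? b _) ∘ subst (x ∈_) t≡
    where
    v-bit : gray (toℕ v) (toℕ b) ≡ gray (toℕ u) (toℕ b)
    v-bit = trans (cong (λ m → gray m (toℕ b)) (sym u+1≡v)) (sym kept)

corollary3p10 : ∀ (n : ℕ) → 3 ≤ n →
    ∃[ r ] ∃[ b ] ∃[ m ]
      (IsR n r × IsBC n b × IsN n m ×
       r ≤ b × b ≡ m × m ≤ 2 * ⌈log₂ n ⌉ + 1)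
corollary3p10 n 3≤n =
  let m , isN@(m-covering , m-least) = least (CycleCovering n) (CycleCovering? n) _ (grayCovering n)
      n≤mC⌊m/2⌋ = cycleCovering⇒n≤kC⌊k/2⌋ 3≤n m-covering
      r , isR@(_ , r-least) = least (λ c → n ≤ c C ⌊ c /2⌋) (λ c → n ℕ.≤? c C ⌊ c /2⌋) m n≤mC⌊m/2⌋
  in r , m , m , isR
   , IsLeast-⇔ cycleCovering⇒bicliqueCover bicliqueCover⇒cycleCovering isN
   , isN , r-least m n≤mC⌊m/2⌋ , refl
   , ≤-trans (m-least _ (grayCovering n)) (≤-reflexive (2L+1 ⌈log₂ n ⌉))
  where
  2L+1 : ∀ L → suc (L + L) ≡ 2 * L + 1
  2L+1 L = trans (cong (λ m → suc (L + m)) (sym (+-identityʳ L))) (+-comm 1 (2 * L))
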